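{- LLPO is equivalent to the statement that for all $a,b\in\mathbb{R}$ the set $\{a,b,\inf\{a,b\},\sup\{a,b\}\}$ is the closure of $\{a,b\}$.
   Context: Work in Bishop-style constructive mathematics: intuitionistic logic with countable and dependent choice; "equivalent" means mutual implication over this base. LLPO (lesser limited principle of omniscience): if $(a_n)_{n\ge1}$ is a binary sequence with at most one term equal to $1$, then either $a_{2n}=0$ for all $n$, or $a_{2n+1}=0$ for all $n$. A finite set $\{c_1,\dots,c_k\}$ of reals means $\{x\in\mathbb{R} : x=c_1\vee\dots\vee x=c_k\}$; the closure of a set $A\subseteq\mathbb{R}$ is the set of $x$ such that for every $\varepsilon>0$ there is $y\in A$ with $|x-y|<\varepsilon$. -}

module Defs where

-- Bishop's constructive real numbers as regular Cauchy sequences of rationals.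
-- Indices are 0-based: index k plays the role of Bishop's index k+1,
-- so Bishop's 1/n becomes  ε k = 1/(k+1).

open import Data.Nat using (ℕ; suc; _*_)
open import Data.Integer using (+_)
open import Data.Rational using (ℚ; _/_; _+_; _-_; ∣_∣; _⊓_; _⊔_; _≤_; _<_; 0ℚ)
open import Data.Bool using (Bool; true; false)
open import Data.Product using (Σ; ∃; _×_)
open import Data.Sum using (_⊎_)
open import Relation.Binary.PropositionalEquality using (_≡_)

Seq : Set
Seq = ℕ → ℚ

ε : ℕ → ℚ
ε k = + 1 / suc k

record ℝ : Set where
  constructor mkℝ
  field
    seq : Seq
    reg : ∀ m n → ∣ seq m - seq n ∣ ≤ ε m + ε n
open ℝ public

-- Bishop's operations, on the underlying sequences
-- (x - y)_n = x_{2n} - y_{2n}   (Bishop index 2(k+1) = 0-based index 2k+1)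
_-ₛ_ : Seq → Seq → Seq
(x -ₛ y) k = x (suc (2 * k)) - y (suc (2 * k))

∣_∣ₛ : Seq → Seq
∣ x ∣ₛ k = ∣ x k ∣

minₛ : Seq → Seq → Seq
minₛ x y k = x k ⊓ y k

maxₛ : Seq → Seq → Seq
maxₛ x y k = x k ⊔ y k

0ₛ : Seq
0ₛ k = 0ℚ

_≈ₛ_ : Seq → Seq → Set
x ≈ₛ y = ∀ k → ∣ x k - y k ∣ ≤ ε k + ε k

Positive : Seq → Set
Positive x = ∃ λ k → ε k < x k

_<ₛ_ : Seq → Seq → Set
x <ₛ y = Positive (y -ₛ x)

_≈ℝ_ : ℝ → ℝ → Set
x ≈ℝ y = seq x ≈ₛ seq y

_<ℝ_ : ℝ → ℝ → Set
x <ℝ y = seq x <ₛ seq y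

inf₂ : ℝ → ℝ → Seq
inf₂ a b = minₛ (seq a) (seq b)

sup₂ : ℝ → ℝ → Seq
sup₂ a b = maxₛ (seq a) (seq b)

_∈₂_ : ℝ → ℝ × ℝ → Set
x ∈₂ (a Data.Product., b) = x ≈ℝ a ⊎ x ≈ℝ b

In4 : ℝ → ℝ → ℝ → Set
In4 a b x = x ≈ℝ a ⊎ x ≈ℝ b ⊎ seq x ≈ₛ inf₂ a b ⊎ seq x ≈ₛ sup₂ a b

InClosure₂ : ℝ → ℝ → ℝ → Set
InClosure₂ a b x =
  (e : ℝ) → 0ₛ <ₛ seq e →
  Σ ℝ λ y → (y ∈₂ (a Data.Product., b)) × (∣ seq x -ₛ seq y ∣ₛ <ₛ seq e)

AtMostOneTrue : (ℕ → Bool) → Set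
AtMostOneTrue α = ∀ m n → α m ≡ true → α n ≡ true → m ≡ n

LLPO : Set
LLPO = (α : ℕ → Bool) → AtMostOneTrue α →
       ((n : ℕ) → α (2 * n) ≡ false) ⊎ ((n : ℕ) → α (suc (2 * n)) ≡ false)

ClosureIsFour : Set
ClosureIsFour = (a b : ℝ) → (x : ℝ) →
  (In4 a b x → InClosure₂ a b x) × (InClosure₂ a b x → In4 a b x)

module Submission where

-- LLPO ⇒ closure is four.  {a,b,inf,sup} lies in the closure without any
-- omniscience, since at each stage min and max of two rationals are one of
-- them (four⇒closure).  Conversely, let x be in the closure; at each stage
-- j it is found near a or near b.  Apply LLPO to the sequence recording, at
-- the first stage n where a and b are visibly apart, whether x was found
-- near b (position 2n) or near a (position 2n+1); the branch LLPO chooses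
-- gives x = a or x = b (near-at-first-apart⇒≈).
--
-- Closure is four ⇒ LLPO.  From α with at most one true term, at index i,
-- build reals t, a, b that are 0 until i is found and then ε i, ε i, 0
-- (i even) or -ε i, 0, -ε i (i odd).  Stagewise t equals a or b, so t is in
-- the closure; each of t = a, b, inf, sup rules out one parity of i.

open import Data.Bool using (Bool; true; false; not; _∧_)
open import Data.Bool.Properties using (∧-conicalˡ; ∧-conicalʳ; not-¬; not-injective; ¬-not)
open import Data.Empty using (⊥; ⊥-elim)
open import Data.Integer as ℤ using (+_; +[1+_]; -[1+_])
import Data.Integer.Properties as ℤP
import Data.Integer.Solver
open import Data.Maybe using (Maybe; just; nothing; maybe′; is-nothing)
import Data.Maybe.Properties as MaybeP
open import Data.Nat as ℕ using (ℕ; zero; suc)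
import Data.Nat.Properties as ℕP
open import Data.Product using (Σ; ∃; _×_; _,_; proj₁; proj₂)
open import Data.Rational as ℚ using (ℚ; mkℚ; _/_; _+_; _-_; -_; ∣_∣; _≤_; _<_; _⊓_; _⊔_; 0ℚ; toℚᵘ)
import Data.Rational.Properties as ℚP
import Data.Rational.Solver
open import Data.Rational.Unnormalised as ℚᵘ using (mkℚᵘ; *≤*; *<*; *≡*)
import Data.Rational.Unnormalised.Properties as ℚᵘP
open import Data.Sum using (_⊎_; inj₁; inj₂; swap)
open import Function.Bundles using (_⇔_; mk⇔)
open import Relation.Binary using (tri<; tri≈; tri>)
open import Relation.Binary.PropositionalEquality
open import Relation.Nullary using (¬_; Dec; yes; no; does)

open import Defs


frac : ℕ → ℕ → ℚ
frac c j = + c / suc j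

frac-unnormalised : ∀ c j → toℚᵘ (frac c j) ℚᵘ.≃ mkℚᵘ (+ c) j
frac-unnormalised c j = ℚP.toℚᵘ-fromℚᵘ (mkℚᵘ (+ c) j)

frac-≤ : ∀ c j d l → c ℕ.* suc l ℕ.≤ d ℕ.* suc j → frac c j ≤ frac d l
frac-≤ c j d l h = ℚP.toℚᵘ-cancel-≤
  (ℚᵘP.≤-respʳ-≃ (ℚᵘP.≃-sym (frac-unnormalised d l))
    (ℚᵘP.≤-respˡ-≃ (ℚᵘP.≃-sym (frac-unnormalised c j))
      (*≤* (subst₂ ℤ._≤_ (ℤP.pos-* c (suc l)) (ℤP.pos-* d (suc j)) (ℤ.+≤+ h)))))

frac-< : ∀ c j d l → c ℕ.* suc l ℕ.< d ℕ.* suc j → frac c j < frac d l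
frac-< c j d l h = ℚP.toℚᵘ-cancel-<
  (ℚᵘP.<-respʳ-≃ (ℚᵘP.≃-sym (frac-unnormalised d l))
    (ℚᵘP.<-respˡ-≃ (ℚᵘP.≃-sym (frac-unnormalised c j))
      (*<* (subst₂ ℤ._<_ (ℤP.pos-* c (suc l)) (ℤP.pos-* d (suc j)) (ℤ.+<+ h)))))

-- Fractions with a common denominator add numerators; this turns all the
-- error bookkeeping below into arithmetic on numerals.
frac-+ : ∀ a b j → frac a j + frac b j ≡ frac (a ℕ.+ b) j
frac-+ a b j = ℚP.toℚᵘ-injective (ℚᵘP.≃-trans (ℚP.toℚᵘ-homo-+ (frac a j) (frac b j))
  (ℚᵘP.≃-trans (ℚᵘP.+-cong (frac-unnormalised a j) (frac-unnormalised b j))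
    (ℚᵘP.≃-trans sum (ℚᵘP.≃-sym (frac-unnormalised (a ℕ.+ b) j)))))
  where
  open ≡-Reasoning
  open Data.Integer.Solver.+-*-Solver
  sum : (mkℚᵘ (+ a) j ℚᵘ.+ mkℚᵘ (+ b) j) ℚᵘ.≃ mkℚᵘ (+ (a ℕ.+ b)) j
  sum = *≡* (begin
    (+ a ℤ.* + suc j ℤ.+ + b ℤ.* + suc j) ℤ.* + suc j
      ≡⟨ solve 3 (λ A B S → (A :* S :+ B :* S) :* S := (A :+ B) :* (S :* S)) refl (+ a) (+ b) (+ suc j) ⟩
    (+ a ℤ.+ + b) ℤ.* (+ suc j ℤ.* + suc j)
      ≡⟨ cong₂ ℤ._*_ (sym (ℤP.pos-+ a b)) (sym (ℤP.pos-* (suc j) (suc j))) ⟩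
    + (a ℕ.+ b) ℤ.* + (suc j ℕ.* suc j) ∎)

frac-antitone : ∀ c {j l} → j ℕ.≤ l → frac c l ≤ frac c j
frac-antitone c {j} {l} h = frac-≤ c l c j (ℕP.*-monoʳ-≤ c (ℕ.s≤s h))

frac-monotone : ∀ {a b} j → a ℕ.≤ b → frac a j ≤ frac b j
frac-monotone {a} {b} j h = frac-≤ a j b j (ℕP.*-monoˡ-≤ (suc j) h)

frac-nonneg : ∀ c j → 0ℚ ≤ frac c j
frac-nonneg c j = subst (_≤ frac c j) (ℚP.0/n≡0 (suc j)) (frac-monotone {0} {c} j ℕ.z≤n)

ε-antitone : ∀ {j l} → j ℕ.≤ l → ε l ≤ ε j
ε-antitone = frac-antitone 1

ε-nonneg : ∀ j → 0ℚ ≤ ε j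
ε-nonneg = frac-nonneg 1

archimedean : ∀ c q → 0ℚ < q → ∃ λ j → frac c j < q
archimedean c q@(mkℚ +[1+ n ] d _) _ = c ℕ.* suc d , ℚP.toℚᵘ-cancel-<
  (ℚᵘP.<-respˡ-≃ (ℚᵘP.≃-sym (frac-unnormalised c (c ℕ.* suc d)))
    (*<* (subst₂ ℤ._<_ (ℤP.pos-* c (suc d)) (ℤP.pos-* (suc n) (suc (c ℕ.* suc d)))
      (ℤ.+<+ (ℕP.<-≤-trans (ℕP.n<1+n _) (ℕP.m≤n*m (suc (c ℕ.* suc d)) (suc n)))))))
archimedean c (mkℚ (+ zero) _ _) h with ℚ.positive h
... | ()
archimedean c (mkℚ -[1+ _ ] _ _) h with ℚ.positive h
... | ()


+-∸-cancel : ∀ p q → (p + q) - q ≡ p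
+-∸-cancel = solve 2 (λ p q → (p :+ q) :- q := p) refl
  where open Data.Rational.Solver.+-*-Solver

∸-+-cancel : ∀ p q → (p - q) + q ≡ p
∸-+-cancel = solve 2 (λ p q → (p :- q) :+ q := p) refl
  where open Data.Rational.Solver.+-*-Solver

p+q<r⇒p<r-q : ∀ {p q r} → p + q < r → p < r - q
p+q<r⇒p<r-q {p} {q} h = subst (_< _) (+-∸-cancel p q) (ℚP.+-monoˡ-< (- q) h)

p<r-q⇒p+q<r : ∀ {p q r} → p < r - q → p + q < r
p<r-q⇒p+q<r {p} {q} {r} h = subst (_ <_) (∸-+-cancel r q) (ℚP.+-monoˡ-< q h)

p-q≤r⇒p≤r+q : ∀ {p q r} → p - q ≤ r → p ≤ r + q
p-q≤r⇒p≤r+q {p} {q} h = subst (_≤ _) (∸-+-cancel p q) (ℚP.+-monoˡ-≤ q h)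

p<q⇒0<q-p : ∀ {p q} → p < q → 0ℚ < q - p
p<q⇒0<q-p {p} {q} h = subst (_< q - p) (ℚP.+-inverseʳ p) (ℚP.+-monoˡ-< (- p) h)

p≤p+q : ∀ {p q} → 0ℚ ≤ q → p ≤ p + q
p≤p+q {p} {q} h = subst (_≤ p + q) (ℚP.+-identityʳ p) (ℚP.+-monoʳ-≤ p h)

p≤q+p : ∀ {p q} → 0ℚ ≤ q → p ≤ q + p
p≤q+p {p} {q} h = subst (p ≤_) (ℚP.+-comm p q) (p≤p+q h)

p≤∣p∣ : ∀ p → p ≤ ∣ p ∣
p≤∣p∣ p with ℚP.≤-total 0ℚ p
... | inj₁ 0≤p = ℚP.≤-reflexive (sym (ℚP.0≤p⇒∣p∣≡p 0≤p))
... | inj₂ p≤0 = ℚP.≤-trans p≤0 (ℚP.0≤∣p∣ p)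

dist-self : ∀ p → ∣ p - p ∣ ≡ 0ℚ
dist-self p = cong ∣_∣ (ℚP.+-inverseʳ p)

dist-sym : ∀ p q → ∣ p - q ∣ ≡ ∣ q - p ∣
dist-sym p q = trans (cong ∣_∣ (solve 2 (λ p q → p :- q := :- (q :- p)) refl p q)) (ℚP.∣-p∣≡∣p∣ (q - p))
  where open Data.Rational.Solver.+-*-Solver

dist-triangle : ∀ p q r → ∣ p - r ∣ ≤ ∣ p - q ∣ + ∣ q - r ∣
dist-triangle p q r = subst (λ z → ∣ z ∣ ≤ ∣ p - q ∣ + ∣ q - r ∣)
  (solve 3 (λ p q r → (p :- q) :+ (q :- r) := p :- r) refl p q r)
  (ℚP.∣p+q∣≤∣p∣+∣q∣ (p - q) (q - r))
  where open Data.Rational.Solver.+-*-Solver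

-- p and q differ by at most c/(j+1).  This is a record so that j, c, p and q
-- can be inferred from a proof: the normalised rational c/(j+1) does not
-- determine c syntactically.
record Close (j c : ℕ) (p q : ℚ) : Set where
  constructor close
  field bounded : ∣ p - q ∣ ≤ frac c j

close-trans : ∀ {j a b p q r} → Close j a p q → Close j b q r → Close j (a ℕ.+ b) p r
close-trans {j} {a} {b} {p} {q} {r} (close h₁) (close h₂) =
  close (ℚP.≤-trans (dist-triangle p q r) (subst (_ ≤_) (frac-+ a b j) (ℚP.+-mono-≤ h₁ h₂)))

close-sym : ∀ {j c p q} → Close j c p q → Close j c q p
close-sym {p = p} {q} (close h) = close (subst (_≤ _) (dist-sym p q) h)

close-weaken : ∀ {j c d p q} → c ℕ.≤ d → Close j c p q → Close j d p q
close-weaken {j} c≤d (close h) = close (ℚP.≤-trans h (frac-monotone j c≤d))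

close-earlier : ∀ {i j c p q} → i ℕ.≤ j → Close j c p q → Close i c p q
close-earlier {c = c} i≤j (close h) = close (ℚP.≤-trans h (frac-antitone c i≤j))

lower-bound : ∀ {p q c d} → ∣ p - q ∣ ≤ d → c + d < p → c < q
lower-bound {p} {q} {c} {d} p≈q h = subst (c <_) (+-∸-cancel q d) (p+q<r⇒p<r-q
  (ℚP.<-≤-trans h (subst (p ≤_) (ℚP.+-comm d q) (p-q≤r⇒p≤r+q (ℚP.≤-trans (p≤∣p∣ (p - q)) p≈q)))))

approx-≤ : ∀ K {c d} → (∀ j → d ≤ c + frac K j) → d ≤ c
approx-≤ K {c} {d} bound with d ℚP.≤? c
... | yes d≤c = d≤c
... | no d≰c with archimedean K (d - c) (p<q⇒0<q-p (ℚP.≰⇒> d≰c))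
...   | j , small = ⊥-elim (ℚP.<-irrefl refl
          (ℚP.≤-<-trans (bound j) (subst (_< d) (ℚP.+-comm (frac K j) c) (p<r-q⇒p+q<r small))))

ε-reflects-< : ∀ {j k} → ε k < ε j → j ℕ.≤ k
ε-reflects-< {j} {k} h with j ℕ.≤? k
... | yes j≤k = j≤k
... | no j≰k = ⊥-elim (ℚP.<-irrefl refl (ℚP.<-≤-trans h (ε-antitone (ℕP.<⇒≤ (ℕP.≰⇒> j≰k)))))

-- Differences of reals are sampled at index 2k+1 (Bishop's 2n), which lies past k.
n≤1+2n : ∀ n → n ℕ.≤ suc (2 ℕ.* n)
n≤1+2n n = ℕP.≤-trans (ℕP.m≤n*m n 2) (ℕP.n≤1+n _)


ε+ε-from : ∀ {j m n} → j ℕ.≤ m → j ℕ.≤ n → ε m + ε n ≤ frac 2 j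
ε+ε-from {j} jm jn = subst (_ ≤_) (frac-+ 1 1 j) (ℚP.+-mono-≤ (ε-antitone jm) (ε-antitone jn))

reg-from : ∀ (x : ℝ) {j m n} → j ℕ.≤ m → j ℕ.≤ n → Close j 2 (seq x m) (seq x n)
reg-from x {m = m} {n} jm jn = close (ℚP.≤-trans (reg x m n) (ε+ε-from jm jn))

≈-from : ∀ (x y : ℝ) {j m} → x ≈ℝ y → j ℕ.≤ m → Close j 2 (seq x m) (seq y m)
≈-from x y {m = m} x≈y jm = close (ℚP.≤-trans (x≈y m) (ε+ε-from jm jm))

≈-refl : ∀ (x : ℝ) → x ≈ℝ x
≈-refl x k = subst (_≤ ε k + ε k) (sym (dist-self (seq x k))) (ℚP.+-mono-≤ (ε-nonneg k) (ε-nonneg k))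

const : ℚ → ℝ
const q = mkℝ (λ _ → q) λ m n →
  subst (_≤ ε m + ε n) (sym (dist-self q)) (ℚP.+-mono-≤ (ε-nonneg m) (ε-nonneg n))

Near : ℕ → ℝ → ℝ → ℕ → Set
Near c x p j = ∃ λ m → j ℕ.≤ m × Close j c (seq x m) (seq p m)

near-weaken : ∀ {c d x p j} → c ℕ.≤ d → Near c x p j → Near d x p j
near-weaken c≤d (m , jm , xp) = m , jm , close-weaken c≤d xp

near⇒≈ : ∀ c (x p : ℝ) → (∀ j → Near c x p j) → x ≈ℝ p
near⇒≈ c x p near k = approx-≤ (c ℕ.+ 2) bound
  where
  open ℚP.≤-Reasoning
  bound : ∀ j → ∣ seq x k - seq p k ∣ ≤ (ε k + ε k) + frac (c ℕ.+ 2) j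
  bound j with near j
  ... | m , jm , close xp = begin
    ∣ seq x k - seq p k ∣
      ≤⟨ dist-triangle (seq x k) (seq x m) (seq p k) ⟩
    ∣ seq x k - seq x m ∣ + ∣ seq x m - seq p k ∣
      ≤⟨ ℚP.+-mono-≤ (reg x k m) (dist-triangle (seq x m) (seq p m) (seq p k)) ⟩
    (ε k + ε m) + (∣ seq x m - seq p m ∣ + ∣ seq p m - seq p k ∣)
      ≤⟨ ℚP.+-mono-≤ (ℚP.+-monoʳ-≤ (ε k) (ε-antitone jm))
                     (ℚP.+-mono-≤ xp (ℚP.≤-trans (reg p m k) (ℚP.+-monoˡ-≤ (ε k) (ε-antitone jm)))) ⟩
    (ε k + ε j) + (frac c j + (ε j + ε k))
      ≡⟨ solve 3 (λ a b f → (a :+ b) :+ (f :+ (b :+ a)) := (a :+ a) :+ (f :+ (b :+ b))) refl (ε k) (ε j) (frac c j) ⟩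
    (ε k + ε k) + (frac c j + (ε j + ε j))
      ≡⟨ cong (λ z → (ε k + ε k) + (frac c j + z)) (frac-+ 1 1 j) ⟩
    (ε k + ε k) + (frac c j + frac 2 j)
      ≡⟨ cong (λ z → (ε k + ε k) + z) (frac-+ c 2 j) ⟩
    (ε k + ε k) + frac (c ℕ.+ 2) j ∎
    where open Data.Rational.Solver.+-*-Solver

positive-eventually : ∀ (e : ℝ) → 0ₛ <ₛ seq e → ∀ c → ∃ λ k → ∀ n → k ℕ.≤ n → frac c k < seq e n
positive-eventually e (k₀ , h₀) c = k , above
  where
  E = seq e (suc (2 ℕ.* k₀))
  E-big : ε k₀ < E
  E-big = subst (ε k₀ <_) (ℚP.+-identityʳ E) h₀
  chosen : ∃ λ k → frac (suc c) k < E - ε k₀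
  chosen = archimedean (suc c) (E - ε k₀) (p<q⇒0<q-p E-big)
  k = proj₁ chosen
  margin : frac c k + (ε k₀ + ε k) < E
  margin = subst (_< E) rearrange (p<r-q⇒p+q<r (proj₂ chosen))
    where
    rearrange : frac (suc c) k + ε k₀ ≡ frac c k + (ε k₀ + ε k)
    rearrange = trans (cong (_+ ε k₀) (sym (frac-+ 1 c k)))
      (solve 3 (λ a f b → (a :+ f) :+ b := f :+ (b :+ a)) refl (ε k) (frac c k) (ε k₀))
      where open Data.Rational.Solver.+-*-Solver
  above : ∀ n → k ℕ.≤ n → frac c k < seq e n
  above n k≤n = lower-bound (ℚP.≤-trans (reg e _ n)
    (ℚP.+-mono-≤ (ε-antitone (n≤1+2n k₀)) (ε-antitone k≤n))) margin


StagewiseClose : ℝ → ℝ → ℝ → Set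
StagewiseClose a b x = ∀ m → Σ ℝ λ y → y ∈₂ (a , b) × ∣ seq x m - seq y m ∣ ≤ ε m + ε m

-- Stagewise closeness suffices for membership in the closure: approximate
-- at a stage late enough that the error is below the given positive e.
stagewise⇒closure : ∀ a b x → StagewiseClose a b x → InClosure₂ a b x
stagewise⇒closure a b x stagewise e e>0 = y , y∈ , k , p+q<r⇒p<r-q (ℚP.≤-<-trans estimate (e-big i (n≤1+2n k)))
  where
  k = proj₁ (positive-eventually e e>0 3)
  e-big = proj₂ (positive-eventually e e>0 3)
  i = suc (2 ℕ.* k)
  m = suc (2 ℕ.* i)
  y = proj₁ (stagewise m)
  y∈ = proj₁ (proj₂ (stagewise m))
  D = ∣ seq x m - seq y m ∣
  k≤m : k ℕ.≤ m
  k≤m = ℕP.≤-trans (n≤1+2n k) (n≤1+2n i)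
  estimate : ε k + D ≤ frac 3 k
  estimate = subst (ε k + D ≤_) (frac-+ 1 2 k)
    (ℚP.+-monoʳ-≤ (ε k) (ℚP.≤-trans (proj₂ (proj₂ (stagewise m))) (ε+ε-from k≤m k≤m)))

close-to-one : ∀ (a b x : ℝ) m {v} → v ≡ seq a m ⊎ v ≡ seq b m → ∣ seq x m - v ∣ ≤ ε m + ε m →
  Σ ℝ λ y → y ∈₂ (a , b) × ∣ seq x m - seq y m ∣ ≤ ε m + ε m
close-to-one a b x m (inj₁ refl) x≈v = a , inj₁ (≈-refl a) , x≈v
close-to-one a b x m (inj₂ refl) x≈v = b , inj₂ (≈-refl b) , x≈v

-- Each of a, b, inf{a,b}, sup{a,b} lies in the closure of {a,b}
-- (with no omniscience: min and max of rationals are one of the two).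
four⇒closure : ∀ a b x → In4 a b x → InClosure₂ a b x
four⇒closure a b x x∈ = stagewise⇒closure a b x λ m → stage m x∈
  where
  stage : ∀ m → In4 a b x → Σ ℝ λ y → y ∈₂ (a , b) × ∣ seq x m - seq y m ∣ ≤ ε m + ε m
  stage m (inj₁ x≈a) = close-to-one a b x m (inj₁ refl) (x≈a m)
  stage m (inj₂ (inj₁ x≈b)) = close-to-one a b x m (inj₂ refl) (x≈b m)
  stage m (inj₂ (inj₂ (inj₁ x≈inf))) = close-to-one a b x m (ℚP.⊓-sel (seq a m) (seq b m)) (x≈inf m)
  stage m (inj₂ (inj₂ (inj₂ x≈sup))) = close-to-one a b x m (ℚP.⊔-sel (seq a m) (seq b m)) (x≈sup m)

-- A point of the closure comes 3/(j+1)-close to a or to b past every stage j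
-- (test the closure against the constant 1/(j+1)).
closure⇒near : ∀ a b x → InClosure₂ a b x → ∀ j → Near 3 x a j ⊎ Near 3 x b j
closure⇒near a b x x∈ j = Data.Sum.map (near-via {a}) (near-via {b}) y∈
  where
  ε-step : ε (suc j) < ε j
  ε-step = frac-< 1 (suc j) 1 j (subst₂ ℕ._<_ (sym (ℕP.*-identityˡ (suc j))) (sym (ℕP.*-identityˡ (suc (suc j))))
    (ℕP.n<1+n (suc j)))
  tested = x∈ (const (ε j)) (suc j , subst (ε (suc j) <_) (sym (ℚP.+-identityʳ (ε j))) ε-step)
  y = proj₁ tested
  y∈ = proj₁ (proj₂ tested)
  k = proj₁ (proj₂ (proj₂ tested))
  m = suc (2 ℕ.* suc (2 ℕ.* k))
  D = ∣ seq x m - seq y m ∣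
  sum : ε k + D < ε j
  sum = p<r-q⇒p+q<r (proj₂ (proj₂ (proj₂ tested)))
  j≤m : j ℕ.≤ m
  j≤m = ℕP.≤-trans (ε-reflects-< (ℚP.≤-<-trans (p≤p+q (ℚP.0≤∣p∣ (seq x m - seq y m))) sum))
          (ℕP.≤-trans (n≤1+2n k) (n≤1+2n (suc (2 ℕ.* k))))
  x-near-y : Close j 1 (seq x m) (seq y m)
  x-near-y = close (ℚP.<⇒≤ (ℚP.≤-<-trans (p≤q+p (ε-nonneg k)) sum))
  near-via : ∀ {p} → y ≈ℝ p → Near 3 x p j
  near-via {p} y≈p = m , j≤m , close-trans x-near-y (≈-from y p y≈p j≤m)


search-step : Maybe ℕ → Bool → ℕ → Maybe ℕ
search-step (just i) _ _ = just i
search-step nothing true k = just k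
search-step nothing false _ = nothing

first : (ℕ → Bool) → ℕ → Maybe ℕ
first α zero = nothing
first α (suc k) = search-step (first α k) (α k) k

IsFirst : (ℕ → Bool) → ℕ → Set
IsFirst α n = α n ≡ true × first α n ≡ nothing

first-none : ∀ α k {i} → first α k ≡ nothing → i ℕ.< k → α i ≡ false
first-none α (suc k) {i} e i<1+k with first α k in e₁ | α k in e₂ | e
... | just _ | _ | ()
... | nothing | true | ()
... | nothing | false | _ with ℕP.m≤n⇒m<n∨m≡n (ℕP.≤-pred i<1+k)
...   | inj₁ i<k = first-none α k e₁ i<k
...   | inj₂ refl = e₂

first-sound : ∀ α k {i} → first α k ≡ just i → i ℕ.< k × IsFirst α i
first-sound α (suc k) e with first α k in e₁ | α k in e₂ | e
... | just _ | _ | refl = Data.Product.map₁ ℕP.m≤n⇒m≤1+n (first-sound α k e₁)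
... | nothing | true | refl = ℕP.≤-refl , e₂ , e₁
... | nothing | false | ()

first-stable : ∀ α {m k i} → first α m ≡ just i → m ℕ.≤ k → first α k ≡ just i
first-stable α {m} {i = i} e m≤k = go (ℕP.≤⇒≤′ m≤k)
  where
  go : ∀ {k} → m ℕ.≤′ k → first α k ≡ just i
  go ℕ.≤′-refl = e
  go (ℕ.≤′-step m≤′k) rewrite go m≤′k = refl

first-complete : ∀ α {i} k → α i ≡ true → i ℕ.< k → ∃ λ i′ → first α k ≡ just i′
first-complete α k αi i<k with first α k in e
... | just i′ = i′ , refl
... | nothing with trans (sym αi) (first-none α k e i<k)
...   | ()

first-unique : ∀ α {m n} → IsFirst α m → IsFirst α n → m ≡ n
first-unique α {m} {n} (αm , fm) (αn , fn) with ℕP.<-cmp m n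
... | tri≈ _ m≡n _ = m≡n
... | tri< m<n _ _ with trans (sym αm) (first-none α n fn m<n)
...   | ()
first-unique α {m} {n} (αm , fm) (αn , fn) | tri> _ _ n<m with trans (sym αn) (first-none α m fm n<m)
...   | ()

first-at : ∀ α → AtMostOneTrue α → ∀ {i k} → α i ≡ true → i ℕ.< k → first α k ≡ just i
first-at α amo {i} {k} αi i<k with first-complete α k αi i<k
... | i′ , e = subst (λ z → first α k ≡ just z) (amo i′ i (proj₁ (proj₂ (first-sound α k e))) αi) e


interleave : ∀ {A : Set} → (ℕ → A) → (ℕ → A) → ℕ → A
interleave f g zero = f 0
interleave f g (suc zero) = g 0
interleave f g (suc (suc i)) = interleave (λ n → f (suc n)) (λ n → g (suc n)) i

interleave-even : ∀ {A : Set} (f g : ℕ → A) n → interleave f g (2 ℕ.* n) ≡ f n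
interleave-even f g zero = refl
interleave-even f g (suc n) =
  trans (cong (interleave f g) (ℕP.*-suc 2 n)) (interleave-even (λ n → f (suc n)) (λ n → g (suc n)) n)

interleave-odd : ∀ {A : Set} (f g : ℕ → A) n → interleave f g (suc (2 ℕ.* n)) ≡ g n
interleave-odd f g zero = refl
interleave-odd f g (suc n) =
  trans (cong (λ i → interleave f g (suc i)) (ℕP.*-suc 2 n)) (interleave-odd (λ n → f (suc n)) (λ n → g (suc n)) n)

even-or-odd : ∀ i → ∃ λ n → i ≡ 2 ℕ.* n ⊎ i ≡ suc (2 ℕ.* n)
even-or-odd zero = 0 , inj₁ refl
even-or-odd (suc i) with even-or-odd i
... | n , inj₁ refl = n , inj₂ refl
... | n , inj₂ refl = suc n , inj₁ (cong suc (sym (ℕP.+-suc n (n ℕ.+ 0))))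

split : (ℕ → Bool) → (ℕ → Bool) → ℕ → Bool
split γ c = interleave (λ n → γ n ∧ c n) (λ n → γ n ∧ not (c n))

split-even : ∀ γ c n → split γ c (2 ℕ.* n) ≡ γ n ∧ c n
split-even γ c = interleave-even (λ n → γ n ∧ c n) (λ n → γ n ∧ not (c n))

split-odd : ∀ γ c n → split γ c (suc (2 ℕ.* n)) ≡ γ n ∧ not (c n)
split-odd γ c = interleave-odd (λ n → γ n ∧ c n) (λ n → γ n ∧ not (c n))

∧-true : ∀ x y → x ∧ y ≡ true → x ≡ true × y ≡ true
∧-true x y h = ∧-conicalˡ x y h , ∧-conicalʳ x y h

split-even-hit : ∀ γ c n → split γ c (2 ℕ.* n) ≡ true → γ n ≡ true × c n ≡ true
split-even-hit γ c n h = ∧-true (γ n) (c n) (trans (sym (split-even γ c n)) h)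

split-odd-hit : ∀ γ c n → split γ c (suc (2 ℕ.* n)) ≡ true → γ n ≡ true × not (c n) ≡ true
split-odd-hit γ c n h = ∧-true (γ n) (not (c n)) (trans (sym (split-odd γ c n)) h)

split-no-clash : ∀ γ c → AtMostOneTrue γ → ∀ n n′ →
  split γ c (2 ℕ.* n) ≡ true → split γ c (suc (2 ℕ.* n′)) ≡ true → ⊥
split-no-clash γ c amo n n′ hit hit′
  with amo n n′ (proj₁ (split-even-hit γ c n hit)) (proj₁ (split-odd-hit γ c n′ hit′))
... | refl = not-¬ refl (trans (proj₂ (split-even-hit γ c n hit)) (sym (proj₂ (split-odd-hit γ c n hit′))))

split-at-most-one : ∀ γ c → AtMostOneTrue γ → AtMostOneTrue (split γ c)
split-at-most-one γ c amo i i′ hit hit′ with even-or-odd i | even-or-odd i′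
... | n , inj₁ refl | n′ , inj₁ refl =
  cong (2 ℕ.*_) (amo n n′ (proj₁ (split-even-hit γ c n hit)) (proj₁ (split-even-hit γ c n′ hit′)))
... | n , inj₂ refl | n′ , inj₂ refl =
  cong (λ k → suc (2 ℕ.* k)) (amo n n′ (proj₁ (split-odd-hit γ c n hit)) (proj₁ (split-odd-hit γ c n′ hit′)))
... | n , inj₁ refl | n′ , inj₂ refl = ⊥-elim (split-no-clash γ c amo n n′ hit hit′)
... | n , inj₂ refl | n′ , inj₁ refl = ⊥-elim (split-no-clash γ c amo n′ n hit′ hit)

first-only : (ℕ → Bool) → ℕ → Bool
first-only β n = β n ∧ is-nothing (first β n)

first-only-sound : ∀ β n → first-only β n ≡ true → IsFirst β n
first-only-sound β n h with β n | first β n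
first-only-sound β n h | true | nothing = refl , refl

first-only-complete : ∀ β n → IsFirst β n → first-only β n ≡ true
first-only-complete β n (βn , fn) rewrite βn | fn = refl

first-only-at-most-one : ∀ β → AtMostOneTrue (first-only β)
first-only-at-most-one β m n hm hn = first-unique β (first-only-sound β m hm) (first-only-sound β n hn)


DecidesApart : (ℕ → Bool) → ℝ → ℝ → Set
DecidesApart β p q = ∀ n →
  (β n ≡ true → frac 12 n < ∣ seq p n - seq q n ∣) × (β n ≡ false → Close n 12 (seq p n) (seq q n))

decides-apart-sym : ∀ {β p q} → DecidesApart β p q → DecidesApart β q p
decides-apart-sym {p = p} {q} apart n = Data.Product.map
  (λ far βn → subst (frac 12 n <_) (dist-sym (seq p n) (seq q n)) (far βn))
  (λ near βn → close-sym (near βn))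
  (apart n)

apart? : ℝ → ℝ → ℕ → Bool
apart? p q n = does (frac 12 n ℚP.<? ∣ seq p n - seq q n ∣)

does-true : ∀ {P : Set} (d : Dec P) → does d ≡ true → P
does-true (yes p) _ = p

does-false : ∀ {P : Set} (d : Dec P) → does d ≡ false → ¬ P
does-false (no ¬p) _ = ¬p

apart?-decides : ∀ p q → DecidesApart (apart? p q) p q
apart?-decides p q n = does-true decision , λ h → close (ℚP.≮⇒≥ (does-false decision h))
  where
  decision = frac 12 n ℚP.<? ∣ seq p n - seq q n ∣

-- Suppose x comes 3/(j+1)-close to p or to q past every
-- stage j, and is 3-close to p at the first stage where p and q are apart.
-- Then x = p: before that stage p and q are 12-close, so closeness to q
-- transfers to p; after it, closeness to q contradicts the separation.
near-at-first-apart⇒≈ : ∀ {β} (p q x : ℝ) → DecidesApart β p q →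
  (∀ j → Near 3 x p j ⊎ Near 3 x q j) → (∀ n → IsFirst β n → Near 3 x p n) → x ≈ℝ p
near-at-first-apart⇒≈ {β} p q x apart near near-at-first = near⇒≈ 19 x p near₁₉
  where
  via-q : ∀ j → Near 3 x q j → (b : Bool) → β j ≡ b → Near 19 x p j
  via-q j (m , j≤m , xq) false βj = m , j≤m ,
    close-trans xq (close-trans (reg-from q j≤m ℕP.≤-refl)
      (close-trans (close-sym (proj₂ (apart j) βj)) (reg-from p ℕP.≤-refl j≤m)))
  via-q j (m , j≤m , xq) true βj with first-complete β (suc j) βj (ℕP.n<1+n j)
  ... | n , found with first-sound β (suc j) found
  ...   | n<1+j , first-n with near-at-first n first-n
  ...     | m′ , n≤m′ , xp = ⊥-elim (ℚP.<-irrefl refl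
              (ℚP.<-≤-trans (proj₁ (apart n) (proj₁ first-n)) (Close.bounded pq)))
    where
    n≤j = ℕP.≤-pred n<1+j
    n≤m = ℕP.≤-trans n≤j j≤m
    pq : Close n 12 (seq p n) (seq q n)
    pq = close-trans (reg-from p ℕP.≤-refl n≤m′) (close-trans (close-sym xp)
           (close-trans (reg-from x n≤m′ n≤m) (close-trans (close-earlier n≤j xq) (reg-from q n≤m ℕP.≤-refl))))
  near₁₉ : ∀ j → Near 19 x p j
  near₁₉ j with near j
  ... | inj₁ near-p = near-weaken {3} {19} {x} {p} {j} (ℕP.m≤m+n 3 16) near-p
  ... | inj₂ near-q = via-q j near-q (β j) refl

is-right : ∀ {A B : Set} → A ⊎ B → Bool
is-right (inj₁ _) = false
is-right (inj₂ _) = true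

from-left : ∀ {A B : Set} (s : A ⊎ B) → is-right s ≡ false → A
from-left (inj₁ a) _ = a

from-right : ∀ {A B : Set} (s : A ⊎ B) → is-right s ≡ true → B
from-right (inj₂ b) _ = b

-- Given x in the closure of {a,b}, apply LLPO to the sequence that is true
-- at 2n (resp. 2n+1) iff n is the first stage where a and b are apart and
-- the closure located x near b (resp. near a) there.  The branch LLPO
-- selects says where x was located, and the core estimate concludes.
module FromLLPO (llpo : LLPO) (a b x : ℝ) (x∈ : InClosure₂ a b x) where
  near : ∀ j → Near 3 x a j ⊎ Near 3 x b j
  near = closure⇒near a b x x∈

  β : ℕ → Bool
  β = apart? a b

  near-b? : ℕ → Bool
  near-b? n = is-right (near n)

  α : ℕ → Bool
  α = split (first-only β) near-b?

  at-first-near-a : (∀ n → α (2 ℕ.* n) ≡ false) → ∀ n → IsFirst β n → Near 3 x a n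
  at-first-near-a evens n first-n = from-left (near n)
    (trans (sym (cong (_∧ near-b? n) (first-only-complete β n first-n)))
      (trans (sym (split-even (first-only β) near-b? n)) (evens n)))

  at-first-near-b : (∀ n → α (suc (2 ℕ.* n)) ≡ false) → ∀ n → IsFirst β n → Near 3 x b n
  at-first-near-b odds n first-n = from-right (near n) (not-injective {y = true}
    (trans (sym (cong (_∧ not (near-b? n)) (first-only-complete β n first-n)))
      (trans (sym (split-odd (first-only β) near-b? n)) (odds n))))

  conclude : (∀ n → α (2 ℕ.* n) ≡ false) ⊎ (∀ n → α (suc (2 ℕ.* n)) ≡ false) → In4 a b x
  conclude (inj₁ evens) = inj₁ (near-at-first-apart⇒≈ {β} a b x (apart?-decides a b) near (at-first-near-a evens))
  conclude (inj₂ odds) = inj₂ (inj₁ (near-at-first-apart⇒≈ {β} b a x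
    (decides-apart-sym {β} {a} {b} (apart?-decides a b)) (λ j → swap (near j)) (at-first-near-b odds)))

  result : In4 a b x
  result = conclude (llpo α (split-at-most-one (first-only β) near-b? (first-only-at-most-one β)))

llpo⇒closure-is-four : LLPO → ClosureIsFour
llpo⇒closure-is-four llpo a b x = four⇒closure a b x , FromLLPO.result llpo a b x


first-none-≤ : ∀ α n {i} → first α n ≡ nothing → α i ≡ true → n ℕ.≤ i
first-none-≤ α n {i} fn αi with n ℕ.≤? i
... | yes n≤i = n≤i
... | no n≰i with trans (sym αi) (first-none α n fn (ℕP.≰⇒> n≰i))
...   | ()

first-agree : ∀ α m n {i i′} → first α m ≡ just i → first α n ≡ just i′ → i ≡ i′
first-agree α m n fm fn with ℕP.≤-total m n
... | inj₁ m≤n = MaybeP.just-injective (trans (sym (first-stable α fm m≤n)) fn)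
... | inj₂ n≤m = MaybeP.just-injective (trans (sym fm) (first-stable α fn n≤m))

first-value-seq : (ℕ → Bool) → (ℕ → ℚ) → Seq
first-value-seq α w k = maybe′ w 0ℚ (first α k)

-- If ∣ w i ∣ ≤ 1/(i+1), this sequence is regular: it is 0 until the first
-- true index i is found, and constant w i afterwards.
first-value-regular : ∀ α w → (∀ i → ∣ w i ∣ ≤ ε i) →
  ∀ m n → ∣ first-value-seq α w m - first-value-seq α w n ∣ ≤ ε m + ε n
first-value-regular α w w≤ε m n with first α m in fm | first α n in fn
... | nothing | nothing = subst (_≤ ε m + ε n) (sym (dist-self 0ℚ)) (ℚP.+-mono-≤ (ε-nonneg m) (ε-nonneg n))
... | just i | just i′ rewrite first-agree α m n fm fn =
  subst (_≤ ε m + ε n) (sym (dist-self (w i′))) (ℚP.+-mono-≤ (ε-nonneg m) (ε-nonneg n))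
... | just i | nothing = subst (_≤ ε m + ε n) (sym (cong ∣_∣ (ℚP.+-identityʳ (w i))))
  (ℚP.≤-trans (w≤ε i) (ℚP.≤-trans (ε-antitone (first-none-≤ α n fn (proj₁ (proj₂ (first-sound α m fm)))))
    (p≤q+p (ε-nonneg m))))
... | nothing | just i =
  subst (_≤ ε m + ε n) (sym (trans (cong ∣_∣ (ℚP.+-identityˡ (- w i))) (ℚP.∣-p∣≡∣p∣ (w i))))
  (ℚP.≤-trans (w≤ε i) (ℚP.≤-trans (ε-antitone (first-none-≤ α m fm (proj₁ (proj₂ (first-sound α n fn)))))
    (p≤p+q (ε-nonneg n))))

first-value : (α : ℕ → Bool) (w : ℕ → ℚ) → (∀ i → ∣ w i ∣ ≤ ε i) → ℝ
first-value α w w≤ε = mkℝ (first-value-seq α w) (first-value-regular α w w≤ε)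

first-value-after : ∀ α w → AtMostOneTrue α → ∀ {i k} → α i ≡ true → i ℕ.< k →
  first-value-seq α w k ≡ w i
first-value-after α w amo αi i<k = cong (maybe′ w 0ℚ) (first-at α amo αi i<k)


by-parity : ∀ {A : Set} → A → A → ℕ → A
by-parity x y = interleave (λ _ → x) (λ _ → y)

by-parity-even : ∀ {A : Set} (x y : A) n → by-parity x y (2 ℕ.* n) ≡ x
by-parity-even x y = interleave-even (λ _ → x) (λ _ → y)

by-parity-odd : ∀ {A : Set} (x y : A) n → by-parity x y (suc (2 ℕ.* n)) ≡ y
by-parity-odd x y = interleave-odd (λ _ → x) (λ _ → y)

by-parity-sel : ∀ {A : Set} (x y : A) i → by-parity x y i ≡ x ⊎ by-parity x y i ≡ y
by-parity-sel x y zero = inj₁ refl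
by-parity-sel x y (suc zero) = inj₂ refl
by-parity-sel x y (suc (suc i)) = by-parity-sel x y i

by-parity-agree : ∀ {A : Set} (x y x′ y′ : A) i →
  by-parity x y i ≡ by-parity x y′ i ⊎ by-parity x y i ≡ by-parity x′ y i
by-parity-agree x y x′ y′ zero = inj₁ refl
by-parity-agree x y x′ y′ (suc zero) = inj₂ refl
by-parity-agree x y x′ y′ (suc (suc i)) = by-parity-agree x y x′ y′ i

by-parity-bounded : ∀ {x y : ℚ} i → ∣ x ∣ ≤ ε i → ∣ y ∣ ≤ ε i → ∣ by-parity x y i ∣ ≤ ε i
by-parity-bounded {x} {y} i x≤ y≤ with by-parity-sel x y i
... | inj₁ is-x = subst (λ z → ∣ z ∣ ≤ ε i) (sym is-x) x≤
... | inj₂ is-y = subst (λ z → ∣ z ∣ ≤ ε i) (sym is-y) y≤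

∣ε∣≤ε : ∀ i → ∣ ε i ∣ ≤ ε i
∣ε∣≤ε i = ℚP.≤-reflexive (ℚP.0≤p⇒∣p∣≡p (ε-nonneg i))

∣-ε∣≤ε : ∀ i → ∣ - ε i ∣ ≤ ε i
∣-ε∣≤ε i = subst (_≤ ε i) (sym (ℚP.∣-p∣≡∣p∣ (ε i))) (∣ε∣≤ε i)

-- A stage late enough that 2/(s+1) < 1/(i+1).
late : ℕ → ℕ
late i = suc (suc (2 ℕ.* i))

too-far : ∀ i {d} → d ≡ ε i → ¬ (d ≤ ε (late i) + ε (late i))
too-far i d≡ε near = ℚP.<-irrefl refl (ℚP.≤-<-trans (subst (_≤ ε (late i) + ε (late i)) d≡ε near) late-small)
  where
  late-small : ε (late i) + ε (late i) < ε i
  late-small = subst (_< ε i) (sym (frac-+ 1 1 (late i))) (frac-< 2 (late i) 1 i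
    (subst₂ ℕ._<_ (sym (ℕP.*-suc 2 i)) (sym (ℕP.*-identityˡ (suc (late i)))) (ℕP.n<1+n (late i))))

∣ε-0∣ : ∀ i → ∣ ε i - 0ℚ ∣ ≡ ε i
∣ε-0∣ i = trans (cong ∣_∣ (ℚP.+-identityʳ (ε i))) (ℚP.0≤p⇒∣p∣≡p (ε-nonneg i))

∣-ε-0∣ : ∀ i → ∣ - ε i - 0ℚ ∣ ≡ ε i
∣-ε-0∣ i = trans (cong ∣_∣ (ℚP.+-identityʳ (- ε i)))
  (trans (ℚP.∣-p∣≡∣p∣ (ε i)) (ℚP.0≤p⇒∣p∣≡p (ε-nonneg i)))

-- At every stage t equals a or b, so t lies in the closure of {a,b}; each of
-- t = a, t = b, t = inf{a,b}, t = sup{a,b} excludes one parity for i.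
module ToLLPO (closure : ClosureIsFour) (α : ℕ → Bool) (amo : AtMostOneTrue α) where
  wt wa wb : ℕ → ℚ
  wt i = by-parity (ε i) (- ε i) i
  wa i = by-parity (ε i) 0ℚ i
  wb i = by-parity 0ℚ (- ε i) i

  t a b : ℝ
  t = first-value α wt (λ i → by-parity-bounded i (∣ε∣≤ε i) (∣-ε∣≤ε i))
  a = first-value α wa (λ i → by-parity-bounded i (∣ε∣≤ε i) (ε-nonneg i))
  b = first-value α wb (λ i → by-parity-bounded i (ε-nonneg i) (∣-ε∣≤ε i))

  wt-is-wa-or-wb : ∀ i → wt i ≡ wa i ⊎ wt i ≡ wb i
  wt-is-wa-or-wb i = by-parity-agree (ε i) (- ε i) 0ℚ 0ℚ i

  t-is-a-or-b : ∀ k → seq t k ≡ seq a k ⊎ seq t k ≡ seq b k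
  t-is-a-or-b k = pick (first α k)
    where
    pick : ∀ found → maybe′ wt 0ℚ found ≡ maybe′ wa 0ℚ found ⊎ maybe′ wt 0ℚ found ≡ maybe′ wb 0ℚ found
    pick nothing = inj₁ refl
    pick (just i) = wt-is-wa-or-wb i

  t∈closure : InClosure₂ a b t
  t∈closure = stagewise⇒closure a b t (λ k → close-to-one a b t k (t-is-a-or-b k) (≈-refl t k))

  module Even (n : ℕ) (hit : α (2 ℕ.* n) ≡ true) where
    i = 2 ℕ.* n
    s = late i

    i<s : i ℕ.< s
    i<s = ℕ.s≤s (n≤1+2n i)

    t-val : seq t s ≡ ε i
    t-val = trans (first-value-after α wt amo hit i<s) (by-parity-even (ε i) (- ε i) n)

    a-val : seq a s ≡ ε i
    a-val = trans (first-value-after α wa amo hit i<s) (by-parity-even (ε i) 0ℚ n)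

    b-val : seq b s ≡ 0ℚ
    b-val = trans (first-value-after α wb amo hit i<s) (by-parity-even 0ℚ (- ε i) n)

    t-b : ∣ seq t s - seq b s ∣ ≡ ε i
    t-b = trans (cong₂ (λ u v → ∣ u - v ∣) t-val b-val) (∣ε-0∣ i)

    t-inf : ∣ seq t s - inf₂ a b s ∣ ≡ ε i
    t-inf = trans (cong₂ (λ u v → ∣ u - v ∣) t-val
      (trans (cong₂ _⊓_ a-val b-val) (ℚP.p≥q⇒p⊓q≡q (ε-nonneg i)))) (∣ε-0∣ i)

  module Odd (n : ℕ) (hit : α (suc (2 ℕ.* n)) ≡ true) where
    i = suc (2 ℕ.* n)
    s = late i

    i<s : i ℕ.< s
    i<s = ℕ.s≤s (n≤1+2n i)

    t-val : seq t s ≡ - ε i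
    t-val = trans (first-value-after α wt amo hit i<s) (by-parity-odd (ε i) (- ε i) n)

    a-val : seq a s ≡ 0ℚ
    a-val = trans (first-value-after α wa amo hit i<s) (by-parity-odd (ε i) 0ℚ n)

    b-val : seq b s ≡ - ε i
    b-val = trans (first-value-after α wb amo hit i<s) (by-parity-odd 0ℚ (- ε i) n)

    t-a : ∣ seq t s - seq a s ∣ ≡ ε i
    t-a = trans (cong₂ (λ u v → ∣ u - v ∣) t-val a-val) (∣-ε-0∣ i)

    t-sup : ∣ seq t s - sup₂ a b s ∣ ≡ ε i
    t-sup = trans (cong₂ (λ u v → ∣ u - v ∣) t-val
      (trans (cong₂ _⊔_ a-val b-val) (ℚP.p≥q⇒p⊔q≡p (ℚP.neg-antimono-≤ (ε-nonneg i))))) (∣-ε-0∣ i)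

  decide : In4 a b t → (∀ n → α (2 ℕ.* n) ≡ false) ⊎ (∀ n → α (suc (2 ℕ.* n)) ≡ false)
  decide (inj₁ t≈a) = inj₂ λ n → ¬-not λ hit →
    too-far (Odd.i n hit) (Odd.t-a n hit) (t≈a (Odd.s n hit))
  decide (inj₂ (inj₁ t≈b)) = inj₁ λ n → ¬-not λ hit →
    too-far (Even.i n hit) (Even.t-b n hit) (t≈b (Even.s n hit))
  decide (inj₂ (inj₂ (inj₁ t≈inf))) = inj₁ λ n → ¬-not λ hit →
    too-far (Even.i n hit) (Even.t-inf n hit) (t≈inf (Even.s n hit))
  decide (inj₂ (inj₂ (inj₂ t≈sup))) = inj₂ λ n → ¬-not λ hit →
    too-far (Odd.i n hit) (Odd.t-sup n hit) (t≈sup (Odd.s n hit))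

  result : (∀ n → α (2 ℕ.* n) ≡ false) ⊎ (∀ n → α (suc (2 ℕ.* n)) ≡ false)
  result = decide (proj₂ (closure a b t) t∈closure)

closure-is-four⇒llpo : ClosureIsFour → LLPO
closure-is-four⇒llpo closure α amo = ToLLPO.result closure α amo


proposition1p4p3 : LLPO ⇔ ClosureIsFour
proposition1p4p3 = mk⇔ llpo⇒closure-is-four closure-is-four⇒llpo
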